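{- Let $n\ge 2$. Then $$c_n(312)=\sum_{k=2}^{n}a_k(312)\,c_{n+1-k}(312),$$ where $c_j(312)=|\mathcal{C}_j(312)|$ and $a_k(312)=|\{\pi\in\mathcal{C}_k(312):\pi_{k-1}\pi_k=21\}|$.
   Context: $\mathcal{C}_j(312)$ is the set of permutations of $[j]$ (one-line notation $\pi_1\cdots\pi_j$) that consist of a single $j$-cycle and avoid the pattern $312$ (no indices $i<j'<k$ with $\pi_{j'}<\pi_k<\pi_i$). In particular $c_1(312)=1$. -}

module Defs where

open import Data.Nat using (ℕ; zero; suc; _+_; _*_; _∸_) renaming (_≟_ to _ℕ≟_)
open import Data.Fin using (Fin; toℕ) renaming (_<_ to _<ᶠ_)
open import Data.Fin.Properties using (all?; any?; _≟_) renaming (_<?_ to _<ᶠ?_)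
open import Data.Vec using (Vec; []; _∷_; lookup)
open import Data.List using (List; []; _∷_; [_]; map; concatMap; filter; length; upTo; allFin)
open import Data.Product using (_×_; ∃; ∃-syntax)
open import Data.Empty using (⊥)
open import Relation.Nullary using (Dec; yes; no; ¬_)
open import Relation.Nullary.Decidable using (_×-dec_; _→-dec_; ¬?)
open import Relation.Binary.PropositionalEquality using (_≡_)

-- A permutation of [j] in one-line notation is a word π₁⋯π_j, represented as
-- a vector of length j with entries in Fin j (values shifted down by 1).
Word : ℕ → Set
Word j = Vec (Fin j) j

allWords : (m j : ℕ) → List (Vec (Fin m) j)
allWords m zero    = [ [] ]
allWords m (suc j) = concatMap (λ x → map (x ∷_) (allWords m j)) (allFin m)

-- π is a permutation (the map i ↦ π_i is injective, hence bijective on [j])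
IsPerm : ∀ {j} → Word j → Set
IsPerm {j} π = (i i′ : Fin j) → lookup π i ≡ lookup π i′ → i ≡ i′

isPerm? : ∀ {j} (π : Word j) → Dec (IsPerm π)
isPerm? π = all? λ i → all? λ i′ → (lookup π i ≟ lookup π i′) →-dec (i ≟ i′)

iter : ∀ {j} → Word j → ℕ → Fin j → Fin j
iter π zero    x = x
iter π (suc t) x = lookup π (iter π t x)

IsSingleCycle : ∀ {j} → Word j → Set
IsSingleCycle {j} π = (x y : Fin j) → ∃[ t ] (iter π (toℕ {j} t) x ≡ y)

isSingleCycle? : ∀ {j} (π : Word j) → Dec (IsSingleCycle π)
isSingleCycle? π = all? λ x → all? λ y → any? λ t → iter π (toℕ t) x ≟ y

Avoids312 : ∀ {j} → Word j → Set
Avoids312 {j} π = (i j′ k : Fin j) → i <ᶠ j′ → j′ <ᶠ k →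
  ¬ (lookup π j′ <ᶠ lookup π k × lookup π k <ᶠ lookup π i)

avoids312? : ∀ {j} (π : Word j) → Dec (Avoids312 π)
avoids312? π = all? λ i → all? λ j′ → all? λ k →
  (i <ᶠ? j′) →-dec (j′ <ᶠ? k) →-dec
    ¬? ((lookup π j′ <ᶠ? lookup π k) ×-dec (lookup π k <ᶠ? lookup π i))

InC : ∀ {j} → Word j → Set
InC π = IsPerm π × IsSingleCycle π × Avoids312 π

inC? : ∀ {j} (π : Word j) → Dec (InC π)
inC? π = isPerm? π ×-dec isSingleCycle? π ×-dec avoids312? π

-- the last two letters are literally 2 1: π_{k-1} = 2 and π_k = 1
-- (in the 0-based Fin encoding: values 1 and 0); false if length < 2
Ends21 : ∀ {m j} → Vec (Fin m) j → Set
Ends21 []                  = ⊥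
Ends21 (x ∷ [])            = ⊥
Ends21 (x ∷ y ∷ [])        = (toℕ x ≡ 1) × (toℕ y ≡ 0)
Ends21 (x ∷ y ∷ z ∷ rest)  = Ends21 (y ∷ z ∷ rest)

ends21? : ∀ {m j} (v : Vec (Fin m) j) → Dec (Ends21 v)
ends21? []                 = no λ ()
ends21? (x ∷ [])           = no λ ()
ends21? (x ∷ y ∷ [])       = (toℕ x ℕ≟ 1) ×-dec (toℕ y ℕ≟ 0)
ends21? (x ∷ y ∷ z ∷ rest) = ends21? (y ∷ z ∷ rest)

Cset : (j : ℕ) → List (Word j)
Cset j = filter inC? (allWords j j)

c : ℕ → ℕ
c j = length (Cset j)

a : ℕ → ℕ
a k = length (filter ends21? (Cset k))

from2to : ℕ → List ℕ
from2to n = map (2 +_) (upTo (n ∸ 1))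

-- Every π ∈ C_n(312) ends with 1: if 1 stood at a position m < n, avoiding 312 would force every
-- later entry to exceed m, so the positions after m would form a block closed under π.  Let 2
-- stand at position k − 1.  Avoiding 312 then forces the earlier entries to be at most k and the
-- entries strictly between 2 and the final 1 to exceed k.  So π is obtained by gluing
-- τ ∈ C_k(312) ending in 21 (the first k − 1 entries of π followed by 1) to σ ∈ C_{n+1−k}(312)
-- (the remaining entries lowered by k − 1, keeping the final 1), and every such pair glues to a
-- member of C_n(312) with 2 at position k − 1.  Orbits of π project onto orbits of τ and σ and
-- lift back from them, so the cycle condition transfers in both directions; summing the number
-- of pairs over k gives the recurrence.

module Submission where

open import Defs
open import Data.Empty using (⊥; ⊥-elim)
open import Data.Fin using (Fin; toℕ; fromℕ<) renaming (zero to fzero; suc to fsuc)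
open import Data.Fin.Properties using (toℕ-injective; toℕ<n; toℕ-fromℕ<; injective⇒≤; pigeonhole)
open import Data.List using (List; []; _∷_; map; concatMap; filter; length; upTo; cartesianProduct)
open import Data.List.Properties using (length-++; length-map; map-∘; map-cong; map-cong-local)
open import Data.List.Membership.Propositional using (_∈_; find; lose)
open import Data.List.Membership.Propositional.Properties
  using (∈-map⁺; ∈-map⁻; ∈-concatMap⁺; ∈-concatMap⁻; ∈-cartesianProduct⁺; ∈-cartesianProduct⁻;
         ∈-filter⁺; ∈-filter⁻; ∈-upTo⁺; ∈-upTo⁻; ∈-allFin)
open import Data.List.Membership.Propositional.Properties.WithK using (unique∧set⇒bag)
import Data.List.Relation.Unary.All as All
import Data.List.Relation.Unary.All.Properties as All
open import Data.List.Relation.Unary.All.Properties using (all-upTo)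
open import Data.List.Relation.Unary.Any using (here; there)
open import Data.List.Relation.Unary.Unique.Propositional using (Unique; []; _∷_)
open import Data.List.Relation.Unary.Unique.Propositional.Properties
  using (++⁺; map⁺; filter⁺; cartesianProduct⁺; upTo⁺; allFin⁺; Unique[x∷xs]⇒x∉xs)
open import Data.List.Relation.Binary.BagAndSetEquality using (∼bag⇒↭)
open import Data.List.Relation.Binary.Permutation.Propositional.Properties using (↭-length)
open import Data.Nat using (ℕ; zero; suc; _+_; _*_; _∸_; _⊓_; _≤_; _<_; z≤n; s≤s; s≤s⁻¹; _≤?_; _<?_; _≟_)
open import Data.Nat.Properties
open import Data.Nat.GeneralisedArithmetic using (iterate)
open import Data.Nat.Induction using (<-rec)
open import Data.Nat.ListAction using (sum)
open import Data.Product using (_×_; _,_; ∃; ∃₂; proj₁; proj₂; uncurry)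
open import Data.Sum using (_⊎_; inj₁; inj₂)
open import Data.Vec using (Vec; []; _∷_; head; lookup; tabulate)
open import Data.Vec.Properties using (lookup∘tabulate; ∷-injectiveʳ)
open import Function using (_∘_)
open import Function.Bundles using (mk⇔)
open import Relation.Binary.Construct.Closure.ReflexiveTransitive using (Star; ε; _◅_; _◅◅_)
open import Relation.Binary.PropositionalEquality
open import Relation.Nullary using (yes; no; ¬_)

-- Orbits

Reach : (ℕ → ℕ) → ℕ → ℕ → Set
Reach f = Star (λ x y → f x ≡ y)

reach⇒iterate : ∀ {f x y} → Reach f x y → ∃ λ t → iterate f x t ≡ y
reach⇒iterate ε = 0 , refl
reach⇒iterate (refl ◅ r) with t , e ← reach⇒iterate r = suc t , e

iterate⇒reach : ∀ f {x y} t → iterate f x t ≡ y → Reach f x y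
iterate⇒reach f zero    refl = ε
iterate⇒reach f (suc t) e    = refl ◅ iterate⇒reach f t e

iterate-suc : ∀ {A : Set} (f : A → A) x t → iterate f x (suc t) ≡ f (iterate f x t)
iterate-suc f x zero    = refl
iterate-suc f x (suc t) = iterate-suc f (f x) t

iterate-+ : ∀ {A : Set} (f : A → A) x s t → iterate f x (s + t) ≡ iterate f (iterate f x s) t
iterate-+ f x zero    t = refl
iterate-+ f x (suc s) t = iterate-+ f (f x) s t

reach-last : ∀ {f x y} → Reach f x y → x ≡ y ⊎ ∃ λ z → Reach f x z × f z ≡ y
reach-last ε = inj₁ refl
reach-last (refl ◅ r) with reach-last r
... | inj₁ e             = inj₂ (_ , ε , e)
... | inj₂ (z , rz , e)  = inj₂ (z , refl ◅ rz , e)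

reach-preserves : ∀ {f} (Q : ℕ → Set) → (∀ {u} → Q u → Q (f u)) → ∀ {x y} → Reach f x y → Q x → Q y
reach-preserves Q h ε          q = q
reach-preserves Q h (refl ◅ r) q = reach-preserves Q h r (h q)

Bounded : ℕ → (ℕ → ℕ) → Set
Bounded N f = ∀ i → i < N → f i < N

InjectiveOn : ℕ → (ℕ → ℕ) → Set
InjectiveOn N f = ∀ i j → i < N → j < N → f i ≡ f j → i ≡ j

InjectiveOn-≤ : ∀ {a N f} → a ≤ N → InjectiveOn N f → InjectiveOn a f
InjectiveOn-≤ a≤N inj i j qi qj = inj i j (<-≤-trans qi a≤N) (<-≤-trans qj a≤N)

CyclicOn : ℕ → (ℕ → ℕ) → Set
CyclicOn N f = ∀ x y → x < N → y < N → Reach f x y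

iterate-bounded : ∀ {N f} → Bounded N f → ∀ {x} t → x < N → iterate f x t < N
iterate-bounded b zero    q = q
iterate-bounded b (suc t) q = iterate-bounded b t (b _ q)

-- Among the N + 1 points x, f x, …, f^N x two coincide, which shortens any longer path.
iterate-shorten : ∀ {N f} → Bounded N f → ∀ {x y} t → x < N → iterate f x t ≡ y →
  ∃ λ t′ → t′ < N × iterate f x t′ ≡ y
iterate-shorten {N} {f} b {x} {y} = <-rec _ shorten
  where
  shorten : ∀ t → (∀ {s} → s < t → x < N → iterate f x s ≡ y → ∃ λ t′ → t′ < N × iterate f x t′ ≡ y) →
            x < N → iterate f x t ≡ y → ∃ λ t′ → t′ < N × iterate f x t′ ≡ y
  shorten t rec q e with t <? N
  ... | yes t<N = t , t<N , e
  ... | no t≮N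
    with i , j , i<j , fi≡fj ← pigeonhole (n<1+n N)
                                 (λ (i : Fin (suc N)) → fromℕ< (iterate-bounded b (toℕ i) q))
    = rec shorter q (trans path e)
    where
    j≤t : toℕ j ≤ t
    j≤t = ≤-trans (s≤s⁻¹ (toℕ<n j)) (≮⇒≥ t≮N)
    same : iterate f x (toℕ i) ≡ iterate f x (toℕ j)
    same = trans (sym (toℕ-fromℕ< _)) (trans (cong toℕ fi≡fj) (toℕ-fromℕ< _))
    path : iterate f x (toℕ i + (t ∸ toℕ j)) ≡ iterate f x t
    path = begin
      iterate f x (toℕ i + (t ∸ toℕ j))         ≡⟨ iterate-+ f x (toℕ i) (t ∸ toℕ j) ⟩
      iterate f (iterate f x (toℕ i)) (t ∸ toℕ j) ≡⟨ cong (λ z → iterate f z (t ∸ toℕ j)) same ⟩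
      iterate f (iterate f x (toℕ j)) (t ∸ toℕ j) ≡⟨ iterate-+ f x (toℕ j) (t ∸ toℕ j) ⟨
      iterate f x (toℕ j + (t ∸ toℕ j))         ≡⟨ cong (iterate f x) (m+[n∸m]≡n j≤t) ⟩
      iterate f x t                             ∎
      where open ≡-Reasoning
    shorter : toℕ i + (t ∸ toℕ j) < t
    shorter = subst (toℕ i + (t ∸ toℕ j) <_) (m+[n∸m]≡n j≤t) (+-monoˡ-< (t ∸ toℕ j) i<j)

reach-map : ∀ {N f g} (h : ℕ → ℕ) → Bounded N f →
  (∀ i → i < N → h (f i) ≡ h i ⊎ h (f i) ≡ g (h i)) →
  ∀ {x y} → x < N → Reach f x y → Reach g (h x) (h y)
reach-map h b sim q ε = ε
reach-map {g = g} h b sim {x} {y} q (refl ◅ r) with sim x q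
... | inj₁ e = subst (λ u → Reach g u (h y)) e (reach-map h b sim (b x q) r)
... | inj₂ e = sym e ◅ reach-map h b sim (b x q) r

-- Only steps before the first visit of z need to be lifted.
reach-lift : ∀ {M f g} (e : ℕ → ℕ) (z : ℕ) → Bounded M g →
  (∀ u → u < M → u ≢ z → Reach f (e u) (e (g u))) →
  ∀ {u} → u < M → Reach g u z → Reach f (e u) (e z)
reach-lift e z b lift q ε = ε
reach-lift e z b lift {u} q (refl ◅ r) with u ≟ z
... | yes refl = ε
... | no u≢z   = lift u q u≢z ◅◅ reach-lift e z b lift (b u q) r

reach-cong : ∀ {N f g} → (∀ i → i < N → f i ≡ g i) → Bounded N f →
  ∀ {x y} → x < N → Reach f x y → Reach g x y
reach-cong f≗g b q ε          = ε
reach-cong f≗g b q (refl ◅ r) = sym (f≗g _ q) ◅ reach-cong f≗g b (b _ q) r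

-- Counting by injections and lists

injection⇒≤ : ∀ {a b} (h : ℕ → ℕ) → (∀ i → i < a → h i < b) → InjectiveOn a h → a ≤ b
injection⇒≤ {a} {b} h into inj = injective⇒≤ {f = H} H-injective
  where
  H : Fin a → Fin b
  H i = fromℕ< (into (toℕ i) (toℕ<n i))
  H-injective : ∀ {i j} → H i ≡ H j → i ≡ j
  H-injective {i} {j} e = toℕ-injective (inj (toℕ i) (toℕ j) (toℕ<n i) (toℕ<n j)
    (trans (sym (toℕ-fromℕ< _)) (trans (cong toℕ e) (toℕ-fromℕ< _))))

injection⇒+≤ : ∀ {a lo b} (h : ℕ → ℕ) → (∀ i → i < a → lo ≤ h i × h i < b) → InjectiveOn a h →
  lo ≤ b → lo + a ≤ b
injection⇒+≤ {a} {lo} {b} h into inj lo≤b = begin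
  lo + a          ≤⟨ +-monoʳ-≤ lo (injection⇒≤ (λ i → h i ∸ lo) into′ inj′) ⟩
  lo + (b ∸ lo)   ≡⟨ m+[n∸m]≡n lo≤b ⟩
  b               ∎
  where
  open ≤-Reasoning
  into′ : ∀ i → i < a → h i ∸ lo < b ∸ lo
  into′ i q = ∸-monoˡ-< (proj₂ (into i q)) (proj₁ (into i q))
  inj′ : InjectiveOn a (λ i → h i ∸ lo)
  inj′ i j qi qj e = inj i j qi qj (begin-equality
    h i              ≡⟨ m∸n+n≡m (proj₁ (into i qi)) ⟨
    h i ∸ lo + lo    ≡⟨ cong (_+ lo) e ⟩
    h j ∸ lo + lo    ≡⟨ m∸n+n≡m (proj₁ (into j qj)) ⟩
    h j              ∎)

module _ {A B : Set} where

  length-concatMap : ∀ (F : A → List B) xs → length (concatMap F xs) ≡ sum (map (length ∘ F) xs)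
  length-concatMap F []       = refl
  length-concatMap F (x ∷ xs) = trans (length-++ (F x)) (cong (length (F x) +_) (length-concatMap F xs))

  length-cartesianProduct : ∀ (xs : List A) (ys : List B) → length (cartesianProduct xs ys) ≡ length xs * length ys
  length-cartesianProduct []       ys = refl
  length-cartesianProduct (x ∷ xs) ys =
    trans (length-++ (map (x ,_) ys)) (cong₂ _+_ (length-map (x ,_) ys) (length-cartesianProduct xs ys))

  Unique-map⁺-local : ∀ (f : A → B) {xs} → (∀ {x y} → x ∈ xs → y ∈ xs → f x ≡ f y → x ≡ y) →
    Unique xs → Unique (map f xs)
  Unique-map⁺-local f {[]}     inj []            = []
  Unique-map⁺-local f {x ∷ xs} inj (x∉ ∷ unique) =
    All.map⁺ (All.tabulate fx≢) ∷ Unique-map⁺-local f (λ p q → inj (there p) (there q)) unique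
    where
    fx≢ : ∀ {y} → y ∈ xs → f x ≢ f y
    fx≢ y∈xs e = Unique[x∷xs]⇒x∉xs (x∉ ∷ unique) (subst (_∈ xs) (sym (inj (here refl) (there y∈xs) e)) y∈xs)

  Unique-concatMap⁺ : ∀ (F : A → List B) (R : A → B → Set) → (∀ {x x′ y} → R x y → R x′ y → x ≡ x′) →
    ∀ {xs} → (∀ {x y} → x ∈ xs → y ∈ F x → R x y) → (∀ {x} → x ∈ xs → Unique (F x)) →
    Unique xs → Unique (concatMap F xs)
  Unique-concatMap⁺ F R functional tag unique-F []               = []
  Unique-concatMap⁺ F R functional {x ∷ xs} tag unique-F (x∉ ∷ unique) =
    ++⁺ (unique-F (here refl)) (Unique-concatMap⁺ F R functional (tag ∘ there) (unique-F ∘ there) unique) disjoint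
    where
    disjoint : ∀ {y} → ¬ (y ∈ F x × y ∈ concatMap F xs)
    disjoint (y∈Fx , y∈rest) with x′ , x′∈xs , y∈Fx′ ← find (∈-concatMap⁻ F y∈rest) =
      Unique[x∷xs]⇒x∉xs (x∉ ∷ unique)
        (subst (_∈ xs) (functional (tag (there x′∈xs) y∈Fx′) (tag (here refl) y∈Fx)) x′∈xs)

Unique-length : ∀ {A : Set} {xs ys : List A} → Unique xs → Unique ys →
  (∀ {x} → x ∈ xs → x ∈ ys) → (∀ {y} → y ∈ ys → y ∈ xs) → length xs ≡ length ys
Unique-length uxs uys to from = ↭-length (∼bag⇒↭ (unique∧set⇒bag uxs uys (mk⇔ to from)))

-- Cyclic 312-avoiding maps

Avoids312On : ℕ → (ℕ → ℕ) → Set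
Avoids312On N f = ∀ i j k → i < j → j < k → k < N → f j < f k → f k < f i → ⊥

record Cyclic312 (N : ℕ) (f : ℕ → ℕ) : Set where
  field
    bounded   : Bounded N f
    injective : InjectiveOn N f
    cyclic    : CyclicOn N f
    avoids312 : Avoids312On N f

Cyclic312-cong : ∀ {N f g} → (∀ i → i < N → f i ≡ g i) → Cyclic312 N f → Cyclic312 N g
Cyclic312-cong {N} {f} {g} f≗g C = record
  { bounded   = λ i q → subst (_< N) (f≗g i q) (bounded i q)
  ; injective = λ i j qi qj e → injective i j qi qj (trans (f≗g i qi) (trans e (sym (f≗g j qj))))
  ; cyclic    = λ x y qx qy → reach-cong f≗g bounded qx (cyclic x y qx qy)
  ; avoids312 = λ i j k i<j j<k k<N l₁ l₂ →
      let qj = <-trans j<k k<N ; qi = <-trans i<j qj in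
      avoids312 i j k i<j j<k k<N (subst₂ _<_ (sym (f≗g j qj)) (sym (f≗g k k<N)) l₁)
                                  (subst₂ _<_ (sym (f≗g k k<N)) (sym (f≗g i qi)) l₂)
  }
  where open Cyclic312 C

module _ {N : ℕ} {f : ℕ → ℕ} (C : Cyclic312 N f) where
  open Cyclic312 C

  surjective : ∀ y → y < N → ∃ λ z → z < N × f z ≡ y
  surjective y q with reach-last (cyclic (f y) y (bounded y q) q)
  ... | inj₁ e           = y , q , e
  ... | inj₂ (z , r , e) = z , reach-preserves (_< N) (bounded _) r (bounded y q) , e

  -- Positions 0, …, m all carry values below f j: f m = 0, and f i > f j for i < m would be a 312.
  right-of-zero : ∀ {m j} → f m ≡ 0 → m < j → j < N → m < f j
  right-of-zero {m} {j} fm≡0 m<j j<N = injection⇒≤ f below (InjectiveOn-≤ m<N injective)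
    where
    m<N = <-trans m<j j<N
    0<fj : 0 < f j
    0<fj = n≢0⇒n>0 λ fj≡0 → <-irrefl (injective m j m<N j<N (trans fm≡0 (sym fj≡0))) m<j
    below : ∀ i → i < suc m → f i < f j
    below i q with m<1+n⇒m<n∨m≡n q
    ... | inj₂ refl = subst (_< f j) (sym fm≡0) 0<fj
    ... | inj₁ i<m with f i ≟ f j
    ...   | yes e = ⊥-elim (<-irrefl (injective i j (<-trans i<m m<N) j<N e) (<-trans i<m m<j))
    ...   | no ne = ≤∧≢⇒< (≮⇒≥ (avoids312 i m j i<m m<j j<N (subst (_< f j) (sym fm≡0) 0<fj))) ne

last≡0 : ∀ {N f} → Cyclic312 (suc N) f → f N ≡ 0
last≡0 {N} {f} C with m , m<1+N , fm≡0 ← surjective C 0 (s≤s z≤n) with m<1+n⇒m<n∨m≡n m<1+N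
... | inj₂ refl = fm≡0
... | inj₁ m<N  =
  ⊥-elim (<-irrefl refl (proj₁ (reach-preserves Right closed (cyclic N m ≤-refl m<1+N) (m<N , ≤-refl))))
  where
  open Cyclic312 C
  Right : ℕ → Set
  Right u = m < u × u < suc N
  closed : ∀ {u} → Right u → Right (f u)
  closed (m<u , u<1+N) = right-of-zero C fm≡0 m<u u<1+N , bounded _ u<1+N

-- Words as maps on ℕ

entry : ∀ {m j} → Vec (Fin m) j → ℕ → ℕ
entry []       i       = 0
entry (x ∷ xs) zero    = toℕ x
entry (x ∷ xs) (suc i) = entry xs i

entry-lookup : ∀ {m j} (v : Vec (Fin m) j) (i : Fin j) → entry v (toℕ i) ≡ toℕ (lookup v i)
entry-lookup (x ∷ v) fzero    = refl
entry-lookup (x ∷ v) (fsuc i) = entry-lookup v i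

entry-fromℕ< : ∀ {m j} (v : Vec (Fin m) j) {i} (q : i < j) → entry v i ≡ toℕ (lookup v (fromℕ< q))
entry-fromℕ< v q = trans (cong (entry v) (sym (toℕ-fromℕ< q))) (entry-lookup v (fromℕ< q))

entry-bounded : ∀ {m j} (v : Vec (Fin m) j) → ∀ i → i < j → entry v i < m
entry-bounded (x ∷ v) zero    q       = toℕ<n x
entry-bounded (x ∷ v) (suc i) (s≤s q) = entry-bounded v i q

entry-ext : ∀ {m j} (v w : Vec (Fin m) j) → (∀ i → i < j → entry v i ≡ entry w i) → v ≡ w
entry-ext []      []      v≗w = refl
entry-ext (x ∷ v) (y ∷ w) v≗w =
  cong₂ _∷_ (toℕ-injective (v≗w 0 (s≤s z≤n))) (entry-ext v w (λ i q → v≗w (suc i) (s≤s q)))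

entry-≢0⇒< : ∀ {m j} (v : Vec (Fin m) j) {i} → entry v i ≢ 0 → i < j
entry-≢0⇒< []      {i}     e≢0 = ⊥-elim (e≢0 refl)
entry-≢0⇒< (x ∷ v) {zero}  e≢0 = s≤s z≤n
entry-≢0⇒< (x ∷ v) {suc i} e≢0 = s≤s (entry-≢0⇒< v e≢0)

clamp : ∀ {N} → Fin N → ℕ → Fin N
clamp {N} default v with v <? N
... | yes v<N = fromℕ< v<N
... | no _    = default

clamp-< : ∀ {N} (default : Fin N) {v} → v < N → toℕ (clamp default v) ≡ v
clamp-< {N} default {v} q with v <? N
... | yes v<N = toℕ-fromℕ< v<N
... | no v≮N  = ⊥-elim (v≮N q)

fromFunction : (N : ℕ) → (ℕ → ℕ) → Word N
fromFunction N f = tabulate λ i → clamp i (f (toℕ i))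

entry-fromFunction : ∀ N f {i} → i < N → f i < N → entry (fromFunction N f) i ≡ f i
entry-fromFunction N f {i} q b = begin
  entry (fromFunction N f) i                        ≡⟨ entry-fromℕ< (fromFunction N f) q ⟩
  toℕ (lookup (fromFunction N f) (fromℕ< q))        ≡⟨ cong toℕ (lookup∘tabulate _ (fromℕ< q)) ⟩
  toℕ (clamp (fromℕ< q) (f (toℕ (fromℕ< q))))       ≡⟨ cong (λ u → toℕ (clamp (fromℕ< q) (f u))) (toℕ-fromℕ< q) ⟩
  toℕ (clamp (fromℕ< q) (f i))                      ≡⟨ clamp-< (fromℕ< q) b ⟩
  f i                                               ∎
  where open ≡-Reasoning

module _ {N : ℕ} (π : Word N) where

  injectiveOn⇒IsPerm : InjectiveOn N (entry π) → IsPerm π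
  injectiveOn⇒IsPerm inj i j e = toℕ-injective (inj (toℕ i) (toℕ j) (toℕ<n i) (toℕ<n j)
    (trans (entry-lookup π i) (trans (cong toℕ e) (sym (entry-lookup π j)))))

  IsPerm⇒injectiveOn : IsPerm π → InjectiveOn N (entry π)
  IsPerm⇒injectiveOn perm i j qi qj e =
    trans (sym (toℕ-fromℕ< qi)) (trans (cong toℕ (perm _ _ lookups≡)) (toℕ-fromℕ< qj))
    where
    lookups≡ : lookup π (fromℕ< qi) ≡ lookup π (fromℕ< qj)
    lookups≡ = toℕ-injective (trans (sym (entry-fromℕ< π qi)) (trans e (entry-fromℕ< π qj)))

  iter-entry : ∀ t (x : Fin N) → toℕ (iter π t x) ≡ iterate (entry π) (toℕ x) t
  iter-entry zero    x = refl
  iter-entry (suc t) x = begin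
    toℕ (lookup π (iter π t x))            ≡⟨ entry-lookup π (iter π t x) ⟨
    entry π (toℕ (iter π t x))             ≡⟨ cong (entry π) (iter-entry t x) ⟩
    entry π (iterate (entry π) (toℕ x) t)  ≡⟨ iterate-suc (entry π) (toℕ x) t ⟨
    iterate (entry π) (toℕ x) (suc t)      ∎
    where open ≡-Reasoning

  singleCycle⇒cyclic : IsSingleCycle π → CyclicOn N (entry π)
  singleCycle⇒cyclic cycle x y qx qy with t , e ← cycle (fromℕ< qx) (fromℕ< qy) =
    iterate⇒reach (entry π) (toℕ t) (begin
      iterate (entry π) x (toℕ t)                     ≡⟨ cong (λ u → iterate (entry π) u (toℕ t)) (toℕ-fromℕ< qx) ⟨
      iterate (entry π) (toℕ (fromℕ< qx)) (toℕ t)     ≡⟨ iter-entry (toℕ t) (fromℕ< qx) ⟨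
      toℕ (iter π (toℕ t) (fromℕ< qx))                ≡⟨ cong toℕ e ⟩
      toℕ (fromℕ< qy)                                 ≡⟨ toℕ-fromℕ< qy ⟩
      y                                               ∎)
    where open ≡-Reasoning

  cyclic⇒singleCycle : CyclicOn N (entry π) → IsSingleCycle π
  cyclic⇒singleCycle cyc x y
    with t , e ← reach⇒iterate (cyc (toℕ x) (toℕ y) (toℕ<n x) (toℕ<n y))
    with t′ , t′<N , e′ ← iterate-shorten (entry-bounded π) t (toℕ<n x) e =
    fromℕ< t′<N , toℕ-injective (begin
      toℕ (iter π (toℕ (fromℕ< t′<N)) x)          ≡⟨ iter-entry (toℕ (fromℕ< t′<N)) x ⟩
      iterate (entry π) (toℕ x) (toℕ (fromℕ< t′<N)) ≡⟨ cong (iterate (entry π) (toℕ x)) (toℕ-fromℕ< t′<N) ⟩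
      iterate (entry π) (toℕ x) t′                ≡⟨ e′ ⟩
      toℕ y                                       ∎)
    where open ≡-Reasoning

  avoids⇒avoidsOn : Avoids312 π → Avoids312On N (entry π)
  avoids⇒avoidsOn avoids i j k i<j j<k k<N l₁ l₂ =
    avoids (fromℕ< qi) (fromℕ< qj) (fromℕ< k<N)
      (subst₂ _<_ (sym (toℕ-fromℕ< qi)) (sym (toℕ-fromℕ< qj)) i<j)
      (subst₂ _<_ (sym (toℕ-fromℕ< qj)) (sym (toℕ-fromℕ< k<N)) j<k)
      (subst₂ _<_ (entry-fromℕ< π qj) (entry-fromℕ< π k<N) l₁ ,
       subst₂ _<_ (entry-fromℕ< π k<N) (entry-fromℕ< π qi) l₂)
    where
    qj = <-trans j<k k<N
    qi = <-trans i<j qj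

  avoidsOn⇒avoids : Avoids312On N (entry π) → Avoids312 π
  avoidsOn⇒avoids avoids i j k i<j j<k (l₁ , l₂) =
    avoids (toℕ i) (toℕ j) (toℕ k) i<j j<k (toℕ<n k)
      (subst₂ _<_ (sym (entry-lookup π j)) (sym (entry-lookup π k)) l₁)
      (subst₂ _<_ (sym (entry-lookup π k)) (sym (entry-lookup π i)) l₂)

  InC⇒Cyclic312 : InC π → Cyclic312 N (entry π)
  InC⇒Cyclic312 (perm , cycle , avoids) = record
    { bounded   = entry-bounded π
    ; injective = IsPerm⇒injectiveOn perm
    ; cyclic    = singleCycle⇒cyclic cycle
    ; avoids312 = avoids⇒avoidsOn avoids
    }

  Cyclic312⇒InC : Cyclic312 N (entry π) → InC π
  Cyclic312⇒InC C = injectiveOn⇒IsPerm injective , cyclic⇒singleCycle cyclic , avoidsOn⇒avoids avoids312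
    where open Cyclic312 C

fromFunction-InC : ∀ {N f} → Cyclic312 N f → InC (fromFunction N f)
fromFunction-InC {N} {f} C = Cyclic312⇒InC (fromFunction N f) (Cyclic312-cong agrees C)
  where
  agrees : ∀ i → i < N → f i ≡ entry (fromFunction N f) i
  agrees i q = sym (entry-fromFunction N f q (Cyclic312.bounded C i q))

Ends21⇒entries : ∀ {m} p (v : Vec (Fin m) (suc (suc p))) → Ends21 v → entry v p ≡ 1 × entry v (suc p) ≡ 0
Ends21⇒entries zero    (x ∷ y ∷ [])    e = e
Ends21⇒entries (suc p) (x ∷ y ∷ z ∷ v) e = Ends21⇒entries p (y ∷ z ∷ v) e

entries⇒Ends21 : ∀ {m} p (v : Vec (Fin m) (suc (suc p))) → entry v p ≡ 1 → entry v (suc p) ≡ 0 → Ends21 v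
entries⇒Ends21 zero    (x ∷ y ∷ [])    e₁ e₂ = e₁ , e₂
entries⇒Ends21 (suc p) (x ∷ y ∷ z ∷ v) e₁ e₂ = entries⇒Ends21 p (y ∷ z ∷ v) e₁ e₂

allWords-complete : ∀ m j (v : Vec (Fin m) j) → v ∈ allWords m j
allWords-complete m zero    []      = here refl
allWords-complete m (suc j) (x ∷ v) =
  ∈-concatMap⁺ (λ y → map (y ∷_) (allWords m j)) (lose (∈-allFin x) (∈-map⁺ (x ∷_) (allWords-complete m j v)))

allWords-unique : ∀ m j → Unique (allWords m j)
allWords-unique m zero    = All.[] ∷ []
allWords-unique m (suc j) = Unique-concatMap⁺ (λ x → map (x ∷_) (allWords m j)) (λ x v → head v ≡ x)
  (λ e e′ → trans (sym e) e′) (λ _ → head≡) (λ _ → map⁺ ∷-injectiveʳ (allWords-unique m j)) (allFin⁺ m)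
  where
  head≡ : ∀ {x v} → v ∈ map (x ∷_) (allWords m j) → head v ≡ x
  head≡ v∈ with _ , _ , refl ← ∈-map⁻ _ v∈ = refl

∈Cset⇒InC : ∀ {j} {π : Word j} → π ∈ Cset j → InC π
∈Cset⇒InC {j} π∈ = proj₂ (∈-filter⁻ inC? {xs = allWords j j} π∈)

InC⇒∈Cset : ∀ {j} {π : Word j} → InC π → π ∈ Cset j
InC⇒∈Cset {j} {π} h = ∈-filter⁺ inC? (allWords-complete j j π) h

Cset-unique : ∀ j → Unique (Cset j)
Cset-unique j = filter⁺ inC? (allWords-unique j j)

-- Gluing and splitting

shift : ℕ → ℕ → ℕ
shift p zero    = zero
shift p (suc v) = suc v + suc p

-- π = τ₀ ⋯ τ_p σ′₀ ⋯ σ′_d where σ′ raises the nonzero values of σ by p + 1: the final 0 of τ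
-- is dropped and the final 0 of σ becomes the final 0 of π.
glue : ℕ → (ℕ → ℕ) → (ℕ → ℕ) → ℕ → ℕ
glue p τ σ i with i ≤? p
... | yes _ = τ i
... | no _  = shift p (σ (i ∸ suc p))

glue-≤ : ∀ p τ σ {i} → i ≤ p → glue p τ σ i ≡ τ i
glue-≤ p τ σ {i} i≤p with i ≤? p
... | yes _   = refl
... | no i≰p  = ⊥-elim (i≰p i≤p)

glue-+ : ∀ p τ σ j → glue p τ σ (suc p + j) ≡ shift p (σ j)
glue-+ p τ σ j with suc p + j ≤? p
... | yes 1+p+j≤p = ⊥-elim (<-irrefl refl (≤-trans (s≤s (m≤m+n p j)) 1+p+j≤p))
... | no _        = cong (shift p ∘ σ) (m+n∸m≡n (suc p) j)

≤⊎+ : ∀ p i → i ≤ p ⊎ ∃ λ j → i ≡ suc p + j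
≤⊎+ p i with i ≤? p
... | yes i≤p = inj₁ i≤p
... | no i≰p  = inj₂ (i ∸ suc p , sym (m+[n∸m]≡n (≰⇒> i≰p)))

shift-0⊎> : ∀ p v → shift p v ≡ 0 ⊎ suc p < shift p v
shift-0⊎> p zero    = inj₁ refl
shift-0⊎> p (suc v) = inj₂ (s≤s (m≤n+m (suc p) v))

shift-injective : ∀ p {u v} → shift p u ≡ shift p v → u ≡ v
shift-injective p {zero}  {zero}  e = refl
shift-injective p {suc u} {suc v} e = +-cancelʳ-≡ (suc p) (suc u) (suc v) e

shift-<-mono : ∀ p {u v} → u < v → shift p u < shift p v
shift-<-mono p {zero}  {suc v} q = s≤s z≤n
shift-<-mono p {suc u} {suc v} q = +-monoˡ-< (suc p) q

shift-<-cancel : ∀ p {u v} → shift p u < shift p v → u < v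
shift-<-cancel p {zero}  {suc v} q = s≤s z≤n
shift-<-cancel p {suc u} {suc v} q = +-cancelʳ-< (suc p) (suc u) (suc v) q

suc-+-comm : ∀ p d → d + suc p ≡ suc (p + d)
suc-+-comm p d = trans (+-suc d p) (cong suc (+-comm d p))

shift-< : ∀ p d {v} → v < suc d → shift p v < suc (suc (p + d))
shift-< p d {zero}  q       = s≤s z≤n
shift-< p d {suc v} (s≤s q) = s≤s (subst (suc v + suc p ≤_) (suc-+-comm p d) (+-monoˡ-≤ (suc p) q))

shift-<⁻ : ∀ p d {v} → shift p v < suc (suc (p + d)) → v < suc d
shift-<⁻ p d {zero}  q       = s≤s z≤n
shift-<⁻ p d {suc v} (s≤s q) = s≤s (+-cancelʳ-< (suc p) v d (subst (suc v + suc p ≤_) (sym (suc-+-comm p d)) q))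

shift-∸ : ∀ p v → v ≡ 0 ⊎ suc p < v → shift p (v ∸ suc p) ≡ v
shift-∸ p .0 (inj₁ refl) = refl
shift-∸ p v  (inj₂ q) with v ∸ suc p in eq
... | zero  = ⊥-elim (<-irrefl refl (≤-trans q (m∸n≡0⇒m≤n eq)))
... | suc w = trans (cong (_+ suc p) (sym eq)) (m∸n+n≡m (<⇒≤ q))

+-<-+ : ∀ p d {j} → j < suc d → suc p + j < suc (suc (p + d))
+-<-+ p d q = s≤s (s≤s (+-monoʳ-≤ p (s≤s⁻¹ q)))

+-<-+⁻ : ∀ p d {j} → suc p + j < suc (suc (p + d)) → j < suc d
+-<-+⁻ p d (s≤s q) = s≤s (+-cancelˡ-≤ p _ _ (s≤s⁻¹ q))

glue-cong : ∀ p d {τ τ′ σ σ′} → (∀ i → i ≤ p → τ i ≡ τ′ i) → (∀ j → j < suc d → σ j ≡ σ′ j) →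
  ∀ i → i < suc (suc (p + d)) → glue p τ σ i ≡ glue p τ′ σ′ i
glue-cong p d {τ} {τ′} {σ} {σ′} τ≗τ′ σ≗σ′ i q with ≤⊎+ p i
... | inj₁ l          = trans (glue-≤ p τ σ l) (trans (τ≗τ′ i l) (sym (glue-≤ p τ′ σ′ l)))
... | inj₂ (j , refl) =
  trans (glue-+ p τ σ j) (trans (cong (shift p) (σ≗σ′ j (+-<-+⁻ p d q))) (sym (glue-+ p τ′ σ′ j)))

module Gluing (p d : ℕ) {τ σ : ℕ → ℕ}
  (Cτ : Cyclic312 (suc (suc p)) τ) (τp≡1 : τ p ≡ 1) (τ1+p≡0 : τ (suc p) ≡ 0)
  (Cσ : Cyclic312 (suc d) σ) where

  private
    module T = Cyclic312 Cτ
    module S = Cyclic312 Cσ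
    N = suc (suc (p + d))
    g = glue p τ σ

    σd≡0 : σ d ≡ 0
    σd≡0 = last≡0 Cσ

    ≤⇒<2+ : ∀ {i} → i ≤ p → i < suc (suc p)
    ≤⇒<2+ q = s≤s (m≤n⇒m≤1+n q)

    τ-≤ : ∀ {i} → i ≤ p → τ i ≤ suc p
    τ-≤ q = s≤s⁻¹ (T.bounded _ (≤⇒<2+ q))

    τ-nonzero : ∀ {i} → i ≤ p → τ i ≢ 0
    τ-nonzero {i} q e = <-irrefl (T.injective i (suc p) (≤⇒<2+ q) ≤-refl (trans e (sym τ1+p≡0))) (s≤s q)

    σ-nonzero : ∀ {b} → b < d → σ b ≢ 0
    σ-nonzero {b} q e = <-irrefl (S.injective b d (m<n⇒m<1+n q) ≤-refl (trans e (sym σd≡0))) q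

    front≢back : ∀ {i j} → i ≤ p → g i ≢ g (suc p + j)
    front≢back {i} {j} q e with shift-0⊎> p (σ j)
    ... | inj₁ z   = τ-nonzero q (trans (sym (glue-≤ p τ σ q)) (trans e (trans (glue-+ p τ σ j) z)))
    ... | inj₂ big = <⇒≱ big (subst (_≤ suc p) (trans (sym (glue-≤ p τ σ q)) (trans e (glue-+ p τ σ j))) (τ-≤ q))

    bounded : Bounded N g
    bounded i q with ≤⊎+ p i
    ... | inj₁ l          =
      subst (_< N) (sym (glue-≤ p τ σ l)) (<-≤-trans (T.bounded i (≤⇒<2+ l)) (s≤s (s≤s (m≤m+n p d))))
    ... | inj₂ (j , refl) = subst (_< N) (sym (glue-+ p τ σ j)) (shift-< p d (S.bounded j (+-<-+⁻ p d q)))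

    injective : InjectiveOn N g
    injective i i′ q q′ e with ≤⊎+ p i | ≤⊎+ p i′
    ... | inj₁ l | inj₁ l′ =
      T.injective i i′ (≤⇒<2+ l) (≤⇒<2+ l′) (trans (sym (glue-≤ p τ σ l)) (trans e (glue-≤ p τ σ l′)))
    ... | inj₁ l | inj₂ (j′ , refl) = ⊥-elim (front≢back l e)
    ... | inj₂ (j , refl) | inj₁ l′ = ⊥-elim (front≢back l′ (sym e))
    ... | inj₂ (j , refl) | inj₂ (j′ , refl) = cong (suc p +_) (S.injective j j′ (+-<-+⁻ p d q) (+-<-+⁻ p d q′)
      (shift-injective p (trans (sym (glue-+ p τ σ j)) (trans e (glue-+ p τ σ j′)))))

    avoids312 : Avoids312On N g
    avoids312 i j k i<j j<k k<N l₁ l₂ with ≤⊎+ p k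
    ... | inj₁ k≤p = T.avoids312 i j k i<j j<k (≤⇒<2+ k≤p)
      (subst₂ _<_ (glue-≤ p τ σ j≤p) (glue-≤ p τ σ k≤p) l₁)
      (subst₂ _<_ (glue-≤ p τ σ k≤p) (glue-≤ p τ σ i≤p) l₂)
      where
      j≤p = ≤-trans (<⇒≤ j<k) k≤p
      i≤p = ≤-trans (<⇒≤ i<j) j≤p
    ... | inj₂ (k′ , refl) with ≤⊎+ p i
    ...   | inj₁ i≤p with shift-0⊎> p (σ k′)
    ...     | inj₁ z   = n≮0 (subst (g j <_) (trans (glue-+ p τ σ k′) z) l₁)
    ...     | inj₂ big = <⇒≱ big (≤-trans (<⇒≤ (subst (_< g i) (glue-+ p τ σ k′) l₂))
                                          (subst (_≤ suc p) (sym (glue-≤ p τ σ i≤p)) (τ-≤ i≤p)))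
    avoids312 i j k i<j j<k k<N l₁ l₂ | inj₂ (k′ , refl) | inj₂ (i′ , refl) with ≤⊎+ p j
    ...   | inj₁ j≤p = ⊥-elim (<⇒≱ (≤-trans (s≤s (m≤m+n p i′)) (<⇒≤ i<j)) j≤p)
    ...   | inj₂ (j′ , refl) =
      S.avoids312 i′ j′ k′ (+-cancelˡ-< (suc p) _ _ i<j) (+-cancelˡ-< (suc p) _ _ j<k) (+-<-+⁻ p d k<N)
        (shift-<-cancel p (subst₂ _<_ (glue-+ p τ σ j′) (glue-+ p τ σ k′) l₁))
        (shift-<-cancel p (subst₂ _<_ (glue-+ p τ σ k′) (glue-+ p τ σ i′) l₂))

    τ-path : ∀ z → (∀ u → u < suc (suc p) → u ≢ z → Reach g u (τ u)) →
             ∀ {u} → u < suc (suc p) → Reach τ u z → Reach g u z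
    τ-path z = reach-lift (λ x → x) z T.bounded

    σ-path : ∀ z → (∀ u → u < suc d → u ≢ z → Reach g (suc p + u) (suc p + σ u)) →
             ∀ {u} → u < suc d → Reach σ u z → Reach g (suc p + u) (suc p + z)
    σ-path z = reach-lift (suc p +_) z S.bounded

    τ-step : ∀ u → u < suc (suc p) → u ≢ suc p → Reach g u (τ u)
    τ-step u q u≢1+p = glue-≤ p τ σ (s≤s⁻¹ (≤∧≢⇒< (s≤s⁻¹ q) u≢1+p)) ◅ ε

    σ-step : ∀ u → u < suc d → u ≢ d → Reach g (suc p + u) (suc p + σ u)
    σ-step u q u≢d with σ u | σ-nonzero (≤∧≢⇒< (s≤s⁻¹ q) u≢d) | glue-+ p τ σ u
    ... | zero  | nz | _ = ⊥-elim (nz refl)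
    ... | suc v | _  | e = trans e (+-comm (suc v) (suc p)) ◅ ε

    1+p→end : Reach g (suc p) (suc p + d)
    1+p→end = subst (λ u → Reach g u (suc p + d)) (+-identityʳ (suc p))
                (σ-path d σ-step (s≤s z≤n) (S.cyclic 0 d (s≤s z≤n) ≤-refl))

    end→0 : Reach g (suc p + d) 0
    end→0 = trans (glue-+ p τ σ d) (cong (shift p) σd≡0) ◅ ε

    0→1+p : Reach g 0 (suc p)
    0→1+p = τ-path (suc p) τ-step (s≤s z≤n) (T.cyclic 0 (suc p) (s≤s z≤n) ≤-refl)

    -- Every position reaches 0 through p + 1 → ⋯ → p + 1 + d → 0, and 0 reaches the front along τ
    -- and the back along τ up to p + 1 and then along σ.
    to-0 : ∀ x → x < N → Reach g x 0
    to-0 x q with ≤⊎+ p x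
    ... | inj₁ l = τ-path (suc p) τ-step (≤⇒<2+ l) (T.cyclic x (suc p) (≤⇒<2+ l) ≤-refl) ◅◅ 1+p→end ◅◅ end→0
    ... | inj₂ (b , refl) = σ-path d σ-step (+-<-+⁻ p d q) (S.cyclic b d (+-<-+⁻ p d q) ≤-refl) ◅◅ end→0

    from-0 : ∀ y → y < N → Reach g 0 y
    from-0 y q with ≤⊎+ p y
    ... | inj₁ l = τ-path y τ-step′ (s≤s z≤n) (T.cyclic 0 y (s≤s z≤n) (≤⇒<2+ l))
      where
      τ-step′ : ∀ u → u < suc (suc p) → u ≢ y → Reach g u (τ u)
      τ-step′ u qu u≢y with u ≟ suc p
      ... | no u≢1+p = τ-step u qu u≢1+p
      ... | yes refl = subst (Reach g (suc p)) (sym τ1+p≡0) (1+p→end ◅◅ end→0)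
    ... | inj₂ (b , refl) = 0→1+p ◅◅ subst (λ u → Reach g u (suc p + b)) (+-identityʳ (suc p))
                                        (σ-path b σ-step′ (s≤s z≤n) (S.cyclic 0 b (s≤s z≤n) (+-<-+⁻ p d q)))
      where
      σ-step′ : ∀ u → u < suc d → u ≢ b → Reach g (suc p + u) (suc p + σ u)
      σ-step′ u qu u≢b with u ≟ d
      ... | no u≢d   = σ-step u qu u≢d
      ... | yes refl = subst (λ v → Reach g (suc p + d) (suc p + v)) (sym σd≡0)
                         (subst (Reach g (suc p + d)) (sym (+-identityʳ (suc p))) (end→0 ◅◅ 0→1+p))

  glue-Cyclic312 : Cyclic312 N g
  glue-Cyclic312 = record
    { bounded   = bounded
    ; injective = injective
    ; cyclic    = λ x y qx qy → to-0 x qx ◅◅ from-0 y qy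
    ; avoids312 = avoids312
    }

  glue-p : g p ≡ 1
  glue-p = trans (glue-≤ p τ σ ≤-refl) τp≡1

front : ℕ → (ℕ → ℕ) → ℕ → ℕ
front p f i with i ≤? p
... | yes _ = f i
... | no _  = 0

front-≤ : ∀ p f {i} → i ≤ p → front p f i ≡ f i
front-≤ p f {i} q with i ≤? p
... | yes _ = refl
... | no nq = ⊥-elim (nq q)

front-> : ∀ p f {i} → p < i → front p f i ≡ 0
front-> p f {i} q with i ≤? p
... | yes l = ⊥-elim (<⇒≱ q l)
... | no _  = refl

back : ℕ → (ℕ → ℕ) → ℕ → ℕ
back p f j = f (suc p + j) ∸ suc p

collapse-front : ℕ → ℕ → ℕ → ℕ
collapse-front p d i with i ≤? p
... | yes _ = d
... | no _  = i ∸ suc p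

collapse-front-≤ : ∀ p d {i} → i ≤ p → collapse-front p d i ≡ d
collapse-front-≤ p d {i} q with i ≤? p
... | yes _ = refl
... | no nq = ⊥-elim (nq q)

collapse-front-> : ∀ p d {i} → p < i → collapse-front p d i ≡ i ∸ suc p
collapse-front-> p d {i} q with i ≤? p
... | yes l = ⊥-elim (<⇒≱ q l)
... | no _  = refl

collapse-front-+ : ∀ p d j → collapse-front p d (suc p + j) ≡ j
collapse-front-+ p d j = trans (collapse-front-> p d (s≤s (m≤m+n p j))) (m+n∸m≡n (suc p) j)

module Splitting (p d : ℕ) {f : ℕ → ℕ} (C : Cyclic312 (suc (suc (p + d))) f) (fp≡1 : f p ≡ 1) where

  open Cyclic312 C
  private
    N′ = suc (p + d)
    N  = suc N′

    fN′≡0 : f N′ ≡ 0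
    fN′≡0 = last≡0 C

    p<N′ : p < N′
    p<N′ = s≤s (m≤m+n p d)

    ≤p⇒<N′ : ∀ {i} → i ≤ p → i < N′
    ≤p⇒<N′ q = s≤s (≤-trans q (m≤m+n p d))

    <N′⇒<N : ∀ {i} → i < N′ → i < N
    <N′⇒<N = m<n⇒m<1+n

    middle : ∀ {t} → t < d → p < suc p + t × suc p + t < N′
    middle {t} q = s≤s (m≤m+n p t) , s≤s (+-monoʳ-< p q)

    positions : ∀ {i} → i < N → i ≤ p ⊎ (∃ λ t → t < d × i ≡ suc p + t) ⊎ i ≡ N′
    positions {i} q with ≤⊎+ p i
    ... | inj₁ l = inj₁ l
    ... | inj₂ (t , refl) with m<1+n⇒m<n∨m≡n (+-<-+⁻ p d q)
    ...   | inj₁ t<d  = inj₂ (inj₁ (t , t<d , refl))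
    ...   | inj₂ refl = inj₂ (inj₂ refl)

    nonzero : ∀ {i} → i < N′ → f i ≢ 0
    nonzero {i} q e = <-irrefl (injective i N′ (<N′⇒<N q) ≤-refl (trans e (sym fN′≡0))) q

    right-≥2 : ∀ {j} → p < j → j < N′ → 2 ≤ f j
    right-≥2 {j} p<j j<N′ with f j | nonzero j<N′ | injective j p (<N′⇒<N j<N′) (<N′⇒<N p<N′)
    ... | zero        | nz | _  = ⊥-elim (nz refl)
    ... | suc zero    | _  | jp = ⊥-elim (<-irrefl (sym (jp (sym fp≡1))) p<j)
    ... | suc (suc v) | _  | _  = s≤s (s≤s z≤n)

    -- A value f i > f j with i < p < j would form a 312 with the value 1 at position p.
    left<right : ∀ {i j} → i < p → p < j → j < N′ → f i < f j
    left<right {i} {j} i<p p<j j<N′ with f i ≟ f j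
    ... | yes e = ⊥-elim (<-irrefl (injective i j (<N′⇒<N (≤p⇒<N′ (<⇒≤ i<p))) (<N′⇒<N j<N′) e) (<-trans i<p p<j))
    ... | no ne = ≤∧≢⇒< (≮⇒≥ (avoids312 i p j i<p p<j (<N′⇒<N j<N′) fp<fj)) ne
      where
      fp<fj : f p < f j
      fp<fj = subst (_< f j) (sym fp≡1) (right-≥2 p<j j<N′)

    -- The d positions strictly between p and N′ carry distinct values in (f i, N).
    left-≤ : ∀ {i} → i ≤ p → f i ≤ suc p
    left-≤ {i} i≤p with m≤n⇒m<n∨m≡n i≤p
    ... | inj₂ refl = subst (_≤ suc p) (sym fp≡1) (s≤s z≤n)
    ... | inj₁ i<p  = +-cancelʳ-≤ d (f i) (suc p) (s≤s⁻¹ (injection⇒+≤ (λ t → f (suc p + t)) into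
        (λ t t′ qt qt′ e → +-cancelˡ-≡ (suc p) t t′
          (injective _ _ (<N′⇒<N (proj₂ (middle qt))) (<N′⇒<N (proj₂ (middle qt′))) e))
        (bounded i (<N′⇒<N (≤p⇒<N′ i≤p)))))
      where
      into : ∀ t → t < d → suc (f i) ≤ f (suc p + t) × f (suc p + t) < N
      into t q = left<right i<p (proj₁ (middle q)) (proj₂ (middle q)) , bounded _ (<N′⇒<N (proj₂ (middle q)))

    -- The p + 1 positions 0, …, p carry distinct values in [1, f (p + 1 + t)).
    right-> : ∀ {t} → t < d → suc p < f (suc p + t)
    right-> {t} t<d =
      injection⇒+≤ f into (InjectiveOn-≤ (<N′⇒<N p<N′) injective) (≤-trans (s≤s z≤n) (right-≥2 p<j j<N′))
      where
      p<j = proj₁ (middle t<d)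
      j<N′ = proj₂ (middle t<d)
      into : ∀ i → i < suc p → 1 ≤ f i × f i < f (suc p + t)
      into i q with m<1+n⇒m<n∨m≡n q
      ... | inj₂ refl = n≢0⇒n>0 (nonzero p<N′) , subst (_< f (suc p + t)) (sym fp≡1) (right-≥2 p<j j<N′)
      ... | inj₁ i<p  = n≢0⇒n>0 (nonzero (≤p⇒<N′ (<⇒≤ i<p))) , left<right i<p p<j j<N′

    back-shape : ∀ {j} → j < suc d → f (suc p + j) ≡ 0 ⊎ suc p < f (suc p + j)
    back-shape {j} q with m<1+n⇒m<n∨m≡n q
    ... | inj₂ refl = inj₁ fN′≡0
    ... | inj₁ j<d  = inj₂ (right-> j<d)

    shift-back : ∀ {j} → j < suc d → shift p (back p f j) ≡ f (suc p + j)
    shift-back q = shift-∸ p _ (back-shape q)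

  glue-front-back : ∀ i → i < N → glue p (front p f) (back p f) i ≡ f i
  glue-front-back i q with ≤⊎+ p i
  ... | inj₁ l          = trans (glue-≤ p _ _ l) (front-≤ p f l)
  ... | inj₂ (j , refl) = trans (glue-+ p _ _ j) (shift-back (+-<-+⁻ p d q))

  private
    τ = front p f
    σ = back p f

  front-Cyclic312 : Cyclic312 (suc (suc p)) τ
  front-Cyclic312 = record
    { bounded   = τ-bounded
    ; injective = τ-injective
    ; cyclic    = τ-cyclic
    ; avoids312 = τ-avoids312
    }
    where
    ≤⊎≡ : ∀ {i} → i < suc (suc p) → i ≤ p ⊎ i ≡ suc p
    ≤⊎≡ q with m<1+n⇒m<n∨m≡n q
    ... | inj₁ l = inj₁ (s≤s⁻¹ l)
    ... | inj₂ e = inj₂ e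

    τ1+p≡0 : τ (suc p) ≡ 0
    τ1+p≡0 = front-> p f ≤-refl

    τ-bounded : Bounded (suc (suc p)) τ
    τ-bounded i q with ≤⊎≡ q
    ... | inj₁ l    = subst (_< suc (suc p)) (sym (front-≤ p f l)) (s≤s (left-≤ l))
    ... | inj₂ refl = subst (_< suc (suc p)) (sym τ1+p≡0) (s≤s z≤n)

    τ-injective : InjectiveOn (suc (suc p)) τ
    τ-injective i i′ q q′ e with ≤⊎≡ q | ≤⊎≡ q′
    ... | inj₁ l    | inj₁ l′   = injective i i′ (<N′⇒<N (≤p⇒<N′ l)) (<N′⇒<N (≤p⇒<N′ l′))
                                    (trans (sym (front-≤ p f l)) (trans e (front-≤ p f l′)))
    ... | inj₁ l    | inj₂ refl = ⊥-elim (nonzero (≤p⇒<N′ l) (trans (sym (front-≤ p f l)) (trans e τ1+p≡0)))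
    ... | inj₂ refl | inj₁ l′   = ⊥-elim (nonzero (≤p⇒<N′ l′) (trans (sym (front-≤ p f l′)) (trans (sym e) τ1+p≡0)))
    ... | inj₂ refl | inj₂ refl = refl

    τ-avoids312 : Avoids312On (suc (suc p)) τ
    τ-avoids312 i j k i<j j<k k<2+p l₁ l₂ with ≤⊎≡ k<2+p
    ... | inj₂ refl = n≮0 (subst (τ j <_) τ1+p≡0 l₁)
    ... | inj₁ k≤p  = avoids312 i j k i<j j<k (<N′⇒<N (≤p⇒<N′ k≤p))
      (subst₂ _<_ (front-≤ p f j≤p) (front-≤ p f k≤p) l₁)
      (subst₂ _<_ (front-≤ p f k≤p) (front-≤ p f i≤p) l₂)
      where
      j≤p = ≤-trans (<⇒≤ j<k) k≤p
      i≤p = ≤-trans (<⇒≤ i<j) j≤p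

    -- Collapsing all positions beyond p onto p + 1 turns π into τ: the middle positions are sent
    -- beyond p + 1, so they do not move, and the last one is sent to 0 = τ (p + 1).
    simulates : ∀ i → i < N → f i ⊓ suc p ≡ i ⊓ suc p ⊎ f i ⊓ suc p ≡ τ (i ⊓ suc p)
    simulates i q with positions q
    ... | inj₁ l = inj₂ (begin
      f i ⊓ suc p          ≡⟨ m≤n⇒m⊓n≡m (left-≤ l) ⟩
      f i                  ≡⟨ front-≤ p f l ⟨
      τ i                  ≡⟨ cong τ (m≤n⇒m⊓n≡m (m≤n⇒m≤1+n l)) ⟨
      τ (i ⊓ suc p)        ∎)
      where open ≡-Reasoning
    ... | inj₂ (inj₁ (t , t<d , refl)) =
      inj₁ (trans (m≥n⇒m⊓n≡n (<⇒≤ (right-> t<d))) (sym (m≥n⇒m⊓n≡n (proj₁ (middle t<d)))))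
    ... | inj₂ (inj₂ refl) = inj₂ (begin
      f N′ ⊓ suc p         ≡⟨ cong (_⊓ suc p) fN′≡0 ⟩
      0                    ≡⟨ τ1+p≡0 ⟨
      τ (suc p)            ≡⟨ cong τ (m≥n⇒m⊓n≡n p<N′) ⟨
      τ (N′ ⊓ suc p)       ∎)
      where open ≡-Reasoning

    τ-cyclic : CyclicOn (suc (suc p)) τ
    τ-cyclic x y qx qy = subst₂ (Reach τ) (m≤n⇒m⊓n≡m (s≤s⁻¹ qx)) (m≤n⇒m⊓n≡m (s≤s⁻¹ qy))
      (reach-map (_⊓ suc p) bounded simulates (<-≤-trans qx 2+p≤N)
                 (cyclic x y (<-≤-trans qx 2+p≤N) (<-≤-trans qy 2+p≤N)))
      where
      2+p≤N : suc (suc p) ≤ N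
      2+p≤N = s≤s p<N′

  back-Cyclic312 : Cyclic312 (suc d) σ
  back-Cyclic312 = record
    { bounded   = σ-bounded
    ; injective = σ-injective
    ; cyclic    = σ-cyclic
    ; avoids312 = σ-avoids312
    }
    where
    σ-bounded : Bounded (suc d) σ
    σ-bounded j q = shift-<⁻ p d (subst (_< N) (sym (shift-back q)) (bounded _ (+-<-+ p d q)))

    σ-injective : InjectiveOn (suc d) σ
    σ-injective j j′ q q′ e = +-cancelˡ-≡ (suc p) j j′ (injective _ _ (+-<-+ p d q) (+-<-+ p d q′)
      (trans (sym (shift-back q)) (trans (cong (shift p) e) (shift-back q′))))

    σ-avoids312 : Avoids312On (suc d) σ
    σ-avoids312 i j k i<j j<k k<1+d l₁ l₂ =
      avoids312 (suc p + i) (suc p + j) (suc p + k) (+-monoʳ-< (suc p) i<j) (+-monoʳ-< (suc p) j<k) (+-<-+ p d k<1+d)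
        (subst₂ _<_ (shift-back qj) (shift-back k<1+d) (shift-<-mono p l₁))
        (subst₂ _<_ (shift-back k<1+d) (shift-back qi) (shift-<-mono p l₂))
      where
      qj = <-trans j<k k<1+d
      qi = <-trans i<j qj

    -- Collapsing the front 0, …, p onto d turns π into σ: the front is left only towards
    -- position p + 1, which collapses to 0 = σ d.
    simulates : ∀ i → i < N → collapse-front p d (f i) ≡ collapse-front p d i ⊎
                                collapse-front p d (f i) ≡ σ (collapse-front p d i)
    simulates i q with positions q
    ... | inj₁ l with m≤n⇒m<n∨m≡n (left-≤ l)
    ...   | inj₁ fi≤p = inj₁ (trans (collapse-front-≤ p d (s≤s⁻¹ fi≤p)) (sym (collapse-front-≤ p d l)))
    ...   | inj₂ fi≡1+p = inj₂ (begin
      collapse-front p d (f i)        ≡⟨ cong (collapse-front p d) fi≡1+p ⟩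
      collapse-front p d (suc p)      ≡⟨ collapse-front-> p d (n<1+n p) ⟩
      suc p ∸ suc p                   ≡⟨ n∸n≡0 (suc p) ⟩
      0 ∸ suc p                       ≡⟨ cong (_∸ suc p) fN′≡0 ⟨
      σ d                             ≡⟨ cong σ (collapse-front-≤ p d l) ⟨
      σ (collapse-front p d i)        ∎)
      where open ≡-Reasoning
    simulates i q | inj₂ (inj₁ (t , t<d , refl)) =
      inj₂ (trans (collapse-front-> p d (<-trans (n<1+n p) (right-> t<d)))
                  (cong σ (sym (collapse-front-+ p d t))))
    simulates i q | inj₂ (inj₂ refl) =
      inj₁ (trans (cong (collapse-front p d) fN′≡0)
                  (trans (collapse-front-≤ p d z≤n) (sym (collapse-front-+ p d d))))

    σ-cyclic : CyclicOn (suc d) σ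
    σ-cyclic x y qx qy = subst₂ (Reach σ) (collapse-front-+ p d x) (collapse-front-+ p d y)
      (reach-map (collapse-front p d) bounded simulates (+-<-+ p d qx) (cyclic _ _ (+-<-+ p d qx) (+-<-+ p d qy)))


-- The decomposition of C_n(312)

InA : ∀ {k} → Word k → Set
InA τ = InC τ × Ends21 τ

Aset : (k : ℕ) → List (Word k)
Aset k = filter ends21? (Cset k)

∈Aset⇒InA : ∀ {k} {τ : Word k} → τ ∈ Aset k → InA τ
∈Aset⇒InA {k} τ∈ = let τ∈C , eτ = ∈-filter⁻ ends21? {xs = Cset k} τ∈ in ∈Cset⇒InC τ∈C , eτ

InA⇒∈Aset : ∀ {k} {τ : Word k} → InA τ → τ ∈ Aset k
InA⇒∈Aset (hτ , eτ) = ∈-filter⁺ ends21? (InC⇒∈Cset hτ) eτ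

Aset-unique : ∀ k → Unique (Aset k)
Aset-unique k = filter⁺ ends21? (Cset-unique k)

glueWord : (N p : ℕ) {d : ℕ} → Word (suc (suc p)) → Word (suc d) → Word N
glueWord N p τ σ = fromFunction N (glue p (entry τ) (entry σ))

module _ {p d : ℕ} {τ : Word (suc (suc p))} {σ : Word (suc d)} (hτ : InA τ) (hσ : InC σ) where

  private
    module G = Gluing p d (InC⇒Cyclic312 τ (proj₁ hτ)) (proj₁ (Ends21⇒entries p τ (proj₂ hτ)))
                          (proj₂ (Ends21⇒entries p τ (proj₂ hτ))) (InC⇒Cyclic312 σ hσ)

  entry-glueWord : ∀ {N} → suc (suc (p + d)) ≡ N → ∀ i → i < N →
    entry (glueWord N p τ σ) i ≡ glue p (entry τ) (entry σ) i
  entry-glueWord {N} refl i q =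
    entry-fromFunction N (glue p (entry τ) (entry σ)) q (Cyclic312.bounded G.glue-Cyclic312 i q)

  glueWord-InC : ∀ {N} → suc (suc (p + d)) ≡ N → InC (glueWord N p τ σ) × entry (glueWord N p τ σ) p ≡ 1
  glueWord-InC refl =
    fromFunction-InC G.glue-Cyclic312 , trans (entry-glueWord refl p (s≤s (m≤n⇒m≤1+n (m≤m+n p d)))) G.glue-p

glueWord-injective : ∀ {N p d} {τ τ′ : Word (suc (suc p))} {σ σ′ : Word (suc d)} → suc (suc (p + d)) ≡ N →
  InA τ → InC σ → InA τ′ → InC σ′ → glueWord N p τ σ ≡ glueWord N p τ′ σ′ → τ ≡ τ′ × σ ≡ σ′
glueWord-injective {N} {p} {d} {τ} {τ′} {σ} {σ′} refl hτ hσ hτ′ hσ′ e =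
  entry-ext τ τ′ τ≗τ′ , entry-ext σ σ′ σ≗σ′
  where
  glues≡ : ∀ i → i < N → glue p (entry τ) (entry σ) i ≡ glue p (entry τ′) (entry σ′) i
  glues≡ i q = begin
    glue p (entry τ) (entry σ) i    ≡⟨ entry-glueWord hτ hσ refl i q ⟨
    entry (glueWord N p τ σ) i      ≡⟨ cong (λ w → entry w i) e ⟩
    entry (glueWord N p τ′ σ′) i    ≡⟨ entry-glueWord hτ′ hσ′ refl i q ⟩
    glue p (entry τ′) (entry σ′) i  ∎
    where open ≡-Reasoning
  τ≗τ′ : ∀ i → i < suc (suc p) → entry τ i ≡ entry τ′ i
  τ≗τ′ i q with m<1+n⇒m<n∨m≡n q
  ... | inj₁ i<1+p = trans (sym (glue-≤ p _ _ (s≤s⁻¹ i<1+p)))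
                       (trans (glues≡ i (<-≤-trans q (s≤s (s≤s (m≤m+n p d))))) (glue-≤ p _ _ (s≤s⁻¹ i<1+p)))
  ... | inj₂ refl  =
    trans (proj₂ (Ends21⇒entries p τ (proj₂ hτ))) (sym (proj₂ (Ends21⇒entries p τ′ (proj₂ hτ′))))
  σ≗σ′ : ∀ j → j < suc d → entry σ j ≡ entry σ′ j
  σ≗σ′ j q = shift-injective p
    (trans (sym (glue-+ p _ _ j)) (trans (glues≡ (suc p + j) (+-<-+ p d q)) (glue-+ p _ _ j)))

glueWord-surjective : ∀ {N p d} {π : Word N} → suc (suc (p + d)) ≡ N → InC π → entry π p ≡ 1 →
  ∃₂ λ (τ : Word (suc (suc p))) (σ : Word (suc d)) → InA τ × InC σ × glueWord N p τ σ ≡ π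
glueWord-surjective {N} {p} {d} {π} refl hπ πp≡1 =
  τ , σ , (hτ , eτ) , hσ , entry-ext (glueWord N p τ σ) π glued≗π
  where
  module S = Splitting p d (InC⇒Cyclic312 π hπ) πp≡1
  τ : Word (suc (suc p))
  τ = fromFunction (suc (suc p)) (front p (entry π))
  σ : Word (suc d)
  σ = fromFunction (suc d) (back p (entry π))
  τ≗ : ∀ i → i < suc (suc p) → entry τ i ≡ front p (entry π) i
  τ≗ i q = entry-fromFunction (suc (suc p)) (front p (entry π)) q (Cyclic312.bounded S.front-Cyclic312 i q)
  σ≗ : ∀ j → j < suc d → entry σ j ≡ back p (entry π) j
  σ≗ j q = entry-fromFunction (suc d) (back p (entry π)) q (Cyclic312.bounded S.back-Cyclic312 j q)
  hτ : InC τ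
  hτ = fromFunction-InC S.front-Cyclic312
  hσ : InC σ
  hσ = fromFunction-InC S.back-Cyclic312
  eτ : Ends21 τ
  eτ = entries⇒Ends21 p τ (trans (τ≗ p (s≤s (n≤1+n p))) (trans (front-≤ p _ ≤-refl) πp≡1))
                           (trans (τ≗ (suc p) ≤-refl) (front-> p _ ≤-refl))
  glued≗π : ∀ i → i < N → entry (glueWord N p τ σ) i ≡ entry π i
  glued≗π i q = begin
    entry (glueWord N p τ σ) i                          ≡⟨ entry-glueWord (hτ , eτ) hσ refl i q ⟩
    glue p (entry τ) (entry σ) i                        ≡⟨ glue-cong p d (λ i l → τ≗ i (s≤s (m≤n⇒m≤1+n l))) σ≗ i q ⟩
    glue p (front p (entry π)) (back p (entry π)) i     ≡⟨ S.glue-front-back i q ⟩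
    entry π i                                           ∎
    where open ≡-Reasoning

position-of-1 : ∀ {m} {π : Word (suc (suc m))} → InC π → ∃ λ p → p < suc m × entry π p ≡ 1
position-of-1 {m} {π} hπ with p , p<2+m , πp≡1 ← surjective (InC⇒Cyclic312 π hπ) 1 (s≤s (s≤s z≤n)) =
  p , ≤∧≢⇒< (s≤s⁻¹ p<2+m) (λ { refl → 1+n≢0 (trans (sym πp≡1) (last≡0 (InC⇒Cyclic312 π hπ))) }) ,
  πp≡1

-- The π ∈ C_{m+2}(312) with 2 at position k − 1 = p + 1; values and positions count from 0 here.
gluings : (m p : ℕ) → List (Word (suc (suc m)))
gluings m p = map (uncurry (glueWord (suc (suc m)) p)) (cartesianProduct (Aset (suc (suc p))) (Cset (suc (m ∸ p))))

length-gluings : ∀ m p → length (gluings m p) ≡ a (suc (suc p)) * c (suc (m ∸ p))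
length-gluings m p =
  trans (length-map (uncurry (glueWord (suc (suc m)) p)) (cartesianProduct (Aset (suc (suc p))) (Cset (suc (m ∸ p)))))
        (length-cartesianProduct (Aset (suc (suc p))) (Cset (suc (m ∸ p))))

module _ {m p : ℕ} (p≤m : p ≤ m) where

  private
    size≡ : suc (suc (p + (m ∸ p))) ≡ suc (suc m)
    size≡ = cong (suc ∘ suc) (m+[n∸m]≡n p≤m)
    pairs : List (Word (suc (suc p)) × Word (suc (m ∸ p)))
    pairs = cartesianProduct (Aset (suc (suc p))) (Cset (suc (m ∸ p)))
    glued : Word (suc (suc p)) × Word (suc (m ∸ p)) → Word (suc (suc m))
    glued = uncurry (glueWord (suc (suc m)) p)
    ∈pairs⇒ : ∀ {τσ} → τσ ∈ pairs → InA (proj₁ τσ) × InC (proj₂ τσ)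
    ∈pairs⇒ τσ∈ = let τ∈A , σ∈C = ∈-cartesianProduct⁻ (Aset (suc (suc p))) (Cset (suc (m ∸ p))) τσ∈
                  in ∈Aset⇒InA τ∈A , ∈Cset⇒InC σ∈C

  ∈gluings⇒ : ∀ {π} → π ∈ gluings m p → InC π × entry π p ≡ 1
  ∈gluings⇒ π∈ = glued-InC (∈-map⁻ glued π∈)
    where
    glued-InC : ∀ {π} → ∃ (λ τσ → τσ ∈ pairs × π ≡ glued τσ) → InC π × entry π p ≡ 1
    glued-InC (τσ , τσ∈ , refl) = let hτ , hσ = ∈pairs⇒ τσ∈ in glueWord-InC hτ hσ size≡

  ⇒∈gluings : ∀ {π} → InC π → entry π p ≡ 1 → π ∈ gluings m p
  ⇒∈gluings hπ πp≡1 = glued-∈ (glueWord-surjective size≡ hπ πp≡1)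
    where
    glued-∈ : ∀ {π} → ∃₂ (λ (τ : Word (suc (suc p))) (σ : Word (suc (m ∸ p))) →
                InA τ × InC σ × glueWord (suc (suc m)) p τ σ ≡ π) → π ∈ gluings m p
    glued-∈ (τ , σ , hτ , hσ , refl) = ∈-map⁺ glued (∈-cartesianProduct⁺ (InA⇒∈Aset hτ) (InC⇒∈Cset hσ))

  gluings-unique : Unique (gluings m p)
  gluings-unique = Unique-map⁺-local glued injective (cartesianProduct⁺ (Aset-unique _) (Cset-unique _))
    where
    injective : ∀ {x y} → x ∈ pairs → y ∈ pairs → glued x ≡ glued y → x ≡ y
    injective {τ , σ} {τ′ , σ′} x∈ y∈ e =
      let hτ , hσ = ∈pairs⇒ x∈ ; hτ′ , hσ′ = ∈pairs⇒ y∈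
          τ≡τ′ , σ≡σ′ = glueWord-injective size≡ hτ hσ hτ′ hσ′ e
      in cong₂ _,_ τ≡τ′ σ≡σ′

module _ (m : ℕ) where

  private
    positions : List ℕ
    positions = upTo (suc m)
    ∈positions⇒≤ : ∀ {p} → p ∈ positions → p ≤ m
    ∈positions⇒≤ p∈ = s≤s⁻¹ (∈-upTo⁻ p∈)

  Cset⊆gluings : ∀ {π} → π ∈ Cset (suc (suc m)) → π ∈ concatMap (gluings m) positions
  Cset⊆gluings {π} π∈ = at (position-of-1 (∈Cset⇒InC π∈))
    where
    at : ∃ (λ p → p < suc m × entry π p ≡ 1) → π ∈ concatMap (gluings m) positions
    at (p , p<1+m , πp≡1) =
      ∈-concatMap⁺ (gluings m) (lose (∈-upTo⁺ p<1+m) (⇒∈gluings (s≤s⁻¹ p<1+m) (∈Cset⇒InC π∈) πp≡1))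

  gluings⊆Cset : ∀ {π} → π ∈ concatMap (gluings m) positions → π ∈ Cset (suc (suc m))
  gluings⊆Cset {π} π∈ = from (find (∈-concatMap⁻ (gluings m) π∈))
    where
    from : ∃ (λ p → p ∈ positions × π ∈ gluings m p) → π ∈ Cset (suc (suc m))
    from (p , p∈ , π∈p) = InC⇒∈Cset (proj₁ (∈gluings⇒ (∈positions⇒≤ p∈) π∈p))

  gluings-concat-unique : Unique (concatMap (gluings m) positions)
  gluings-concat-unique = Unique-concatMap⁺ (gluings m) (λ p π → InC π × entry π p ≡ 1) one-position
    (λ p∈ → ∈gluings⇒ (∈positions⇒≤ p∈)) (λ p∈ → gluings-unique (∈positions⇒≤ p∈)) (upTo⁺ (suc m))
    where
    one-position : ∀ {p p′} {π : Word (suc (suc m))} → InC π × entry π p ≡ 1 → InC π × entry π p′ ≡ 1 → p ≡ p′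
    one-position {p} {p′} {π} (hπ , πp≡1) (_ , πp′≡1) =
      IsPerm⇒injectiveOn π (proj₁ hπ) p p′ (entry-≢0⇒< π (λ e → 1+n≢0 (trans (sym πp≡1) e)))
        (entry-≢0⇒< π (λ e → 1+n≢0 (trans (sym πp′≡1) e))) (trans πp≡1 (sym πp′≡1))

corollary3p9 : (n : ℕ) → 2 ≤ n →
    c n ≡ sum (map (λ k → a k * c (n + 1 ∸ k)) (from2to n))
corollary3p9 (suc (suc m)) (s≤s (s≤s z≤n)) = begin
  c (suc (suc m))
    ≡⟨ Unique-length (Cset-unique _) (gluings-concat-unique m) (Cset⊆gluings m) (gluings⊆Cset m) ⟩
  length (concatMap (gluings m) (upTo (suc m)))
    ≡⟨ length-concatMap (gluings m) (upTo (suc m)) ⟩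
  sum (map (length ∘ gluings m) (upTo (suc m)))
    ≡⟨ cong sum (map-cong (length-gluings m) (upTo (suc m))) ⟩
  sum (map (λ p → a (suc (suc p)) * c (suc (m ∸ p))) (upTo (suc m)))
    ≡⟨ cong sum (map-cong-local (All.map reindex (all-upTo (suc m)))) ⟩
  sum (map (λ p → a (suc (suc p)) * c (m + 1 ∸ p)) (upTo (suc m)))
    ≡⟨ cong sum (map-∘ (upTo (suc m))) ⟩
  sum (map (λ k → a k * c (suc (suc m) + 1 ∸ k)) (from2to (suc (suc m))))
    ∎
  where
  open ≡-Reasoning
  reindex : ∀ {p} → p < suc m → a (suc (suc p)) * c (suc (m ∸ p)) ≡ a (suc (suc p)) * c (m + 1 ∸ p)
  reindex {p} p<1+m =
    cong (λ k → a (suc (suc p)) * c k) (sym (trans (+-∸-comm 1 (s≤s⁻¹ p<1+m)) (+-comm (m ∸ p) 1)))
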